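{- Let $r\ge 2$ and $n\ge r^2$. Then there is a graph homomorphism $H_{n:r}\to K_{n':r'}$ where $n'=n!$ and \[r'=\left[\binom{n}{r+1}+\frac{r-1}{r+1}\binom{r^2}{r}\right](n-r-1)!\,r!=\frac{1}{r+1}\Big[n!+(r-1)\big(r^2(r^2-1)\cdots(r^2-r+1)\big)(n-r-1)!\Big].\]
   Context: For positive integers $n,r$ write $[n]=\{1,\dots,n\}$. The Häggkvist–Hell graph $H_{n:r}$ is the graph whose vertices are the ordered pairs $(h,T)$ where $T$ is an $r$-element subset of $[n]$ and $h\in[n]\setminus T$; two vertices $(h_x,T_x)$ and $(h_y,T_y)$ are adjacent iff $h_x\in T_y$, $h_y\in T_x$ and $T_x\cap T_y=\varnothing$. The Kneser graph $K_{n':r'}$ has the $r'$-element subsets of an $n'$-element set as vertices, two being adjacent iff disjoint. -}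

module Defs where

open import Data.Nat using (ℕ)
open import Data.Fin using (Fin)
open import Data.Fin.Subset using (Subset; _∈_; _∉_; _∩_; ∣_∣; Empty)
open import Data.Product using (Σ; _×_; proj₁; proj₂)
open import Relation.Binary.PropositionalEquality using (_≡_)

record HHVertex (n r : ℕ) : Set where
  constructor hhv
  field
    head    : Fin n
    tail    : Subset n
    tailCard : ∣ tail ∣ ≡ r
    headOut : head ∉ tail
open HHVertex public

HHAdj : ∀ {n r} → HHVertex n r → HHVertex n r → Set
HHAdj x y = (head x ∈ tail y) × (head y ∈ tail x) × Empty (tail x ∩ tail y)

record KVertex (n' r' : ℕ) : Set where
  constructor kv
  field
    set  : Subset n'
    card : ∣ set ∣ ≡ r'
open KVertex public

KAdj : ∀ {n' r'} → KVertex n' r' → KVertex n' r' → Set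
KAdj S T = Empty (set S ∩ set T)

IsHom : ∀ {n r n' r'} → (HHVertex n r → KVertex n' r') → Set
IsHom {n} {r} f = ∀ (x y : HHVertex n r) → HHAdj x y → KAdj (f x) (f y)

HHtoKneserHom : ℕ → ℕ → ℕ → ℕ → Set
HHtoKneserHom n r n' r' = Σ (HHVertex n r → KVertex n' r') IsHom

module Submission where

-- A vertex (h , T) gives every point of [n] a role: head h, tail (in T) or
-- other.  At each point, adjacent vertices have compatible roles: a head
-- faces a tail, and two tails never face each other.  For a labelling L of
-- [N] by roles we build S(L) ⊆ [N!], cut into N blocks of size (N-1)!.  At
-- the base level N = m + 1 a tail's block is full and all others empty;
-- above it the head's block is full, a tail's block empty, and the block of
-- an other point i holds S(L without i).  Compatible labellings give disjoint
-- sets block by block, so (h , T) ↦ S(roles) is a homomorphism.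

open import Defs
open import Data.Nat using (ℕ; zero; suc; _+_; _*_; _∸_; _≤_; _!; z≤n; s≤s)
open import Data.Nat.Properties
  using (+-*-semiring; +-identityʳ; *-identityˡ; *-identityʳ; *-zeroʳ; +-comm; *-assoc;
         +-suc; suc-injective; +-cancelˡ-≡; *-cancelˡ-≡; m+n∸m≡n; m≤m*n; m≤n⇒∃[o]m+o≡n; _!≢0)
open import Data.Nat.Combinatorics using (_P_; nPk≡n!/[n∸k]!; [n∸k]!k!∣n!)
open import Data.Nat.DivMod using (_/_; m/n*n≡m)
open import Data.Nat.Divisibility using (∣-trans; m∣m*n)
open import Data.Nat.Solver using (module +-*-Solver)
open import Data.Bool using (Bool; true; false; if_then_else_)
open import Data.Fin using (Fin; zero; suc; punchIn; _≟_)
open import Data.Fin.Properties using (punchInᵢ≢i)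
open import Data.Fin.Subset using (Subset; _∈_; _∉_; _∩_; ∣_∣; Empty; ⊤; ⊥)
open import Data.Fin.Subset.Properties using (∣⊤∣≡n; ∣⊥∣≡0; ∉⊥; ∩-zeroˡ; ∩-zeroʳ; x∈p∩q⁺)
open import Data.Vec using ([]; _∷_; _++_; concat; tabulate; lookup)
open import Data.Vec.Properties using (zipWith-++; []=⇒lookup; lookup⇒[]=)
open import Data.Vec.Functional using (Vector; removeAt)
open import Data.Product using (Σ; _×_; _,_)
open import Function using (_∘_; const)
open import Relation.Nullary using (does; yes; no; ¬_; contradiction)
open import Relation.Binary.PropositionalEquality
open import Algebra.Properties.Semiring.Sum +-*-semiring
  using (sum-syntax; sum-cong-≗; sum-remove; sum-replicate-zero; ∑-distrib-+; *-distribʳ-sum)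

open +-*-Solver using (solve; _:+_; _:*_; _:=_; con)
open ≡-Reasoning

data Role : Set where
  hd tl ot : Role

Labelling : ℕ → Set
Labelling k = Vector Role k

δ : Role → Role → ℕ
δ hd hd = 1
δ tl tl = 1
δ ot ot = 1
δ _  _  = 0

count : ∀ {k} → Labelling k → Role → ℕ
count {k} L ρ = ∑[ i < k ] δ ρ (L i)

count-removeAt : ∀ {k} (L : Labelling (suc k)) a ρ →
                 count L ρ ≡ δ ρ (L a) + count (removeAt L a) ρ
count-removeAt L a ρ = sum-remove {i = a} (δ ρ ∘ L)

∑-by-role : ∀ {k} (L : Labelling k) (ψ : Role → ℕ) →
            ∑[ i < k ] ψ (L i) ≡ count L hd * ψ hd + count L tl * ψ tl + count L ot * ψ ot
∑-by-role {k} L ψ = begin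
  ∑[ i < k ] ψ (L i)                                   ≡⟨ sum-cong-≗ (expand ∘ L) ⟩
  ∑[ i < k ] (weighted hd i + weighted tl i + weighted ot i)
    ≡⟨ ∑-distrib-+ (λ i → weighted hd i + weighted tl i) (weighted ot) ⟩
  ∑[ i < k ] (weighted hd i + weighted tl i) + ∑[ i < k ] weighted ot i
    ≡⟨ cong (_+ ∑[ i < k ] weighted ot i) (∑-distrib-+ (weighted hd) (weighted tl)) ⟩
  ∑[ i < k ] weighted hd i + ∑[ i < k ] weighted tl i + ∑[ i < k ] weighted ot i
    ≡⟨ sym (cong₂ _+_ (cong₂ _+_ (pull hd) (pull tl)) (pull ot)) ⟩
  count L hd * ψ hd + count L tl * ψ tl + count L ot * ψ ot ∎
  where
  weighted : Role → Fin k → ℕ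
  weighted ρ i = δ ρ (L i) * ψ ρ
  pull : ∀ ρ → count L ρ * ψ ρ ≡ ∑[ i < k ] weighted ρ i
  pull ρ = *-distribʳ-sum (ψ ρ) (δ ρ ∘ L)
  expand : ∀ ρ → ψ ρ ≡ δ hd ρ * ψ hd + δ tl ρ * ψ tl + δ ot ρ * ψ ot
  expand hd = sym (trans (+-identityʳ _) (trans (+-identityʳ _) (+-identityʳ _)))
  expand tl = sym (trans (+-identityʳ _) (+-identityʳ _))
  expand ot = sym (+-identityʳ _)

count-total : ∀ {k} (L : Labelling k) → count L hd + count L tl + count L ot ≡ k
count-total {k} L = begin
  count L hd + count L tl + count L ot
    ≡⟨ sym (cong₂ _+_ (cong₂ _+_ (*-identityʳ (count L hd)) (*-identityʳ (count L tl)))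
                      (*-identityʳ (count L ot))) ⟩
  count L hd * 1 + count L tl * 1 + count L ot * 1
    ≡⟨ sym (∑-by-role L (const 1)) ⟩
  ∑[ i < k ] 1
    ≡⟨ ∑-ones k ⟩
  k ∎
  where
  ∑-ones : ∀ k → ∑[ i < k ] 1 ≡ k
  ∑-ones zero    = refl
  ∑-ones (suc k) = cong suc (∑-ones k)

blocks : ∀ {k m} → (Fin k → Subset m) → Subset (k * m)
blocks g = concat (tabulate g)

∣++∣ : ∀ {a b} (p : Subset a) (q : Subset b) → ∣ p ++ q ∣ ≡ ∣ p ∣ + ∣ q ∣
∣++∣ []          q = refl
∣++∣ (true  ∷ p) q = cong suc (∣++∣ p q)
∣++∣ (false ∷ p) q = ∣++∣ p q

∣blocks∣ : ∀ {k m} (g : Fin k → Subset m) → ∣ blocks g ∣ ≡ ∑[ a < k ] ∣ g a ∣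
∣blocks∣ {zero}  g = refl
∣blocks∣ {suc k} g =
  trans (∣++∣ (g zero) (blocks (g ∘ suc))) (cong (∣ g zero ∣ +_) (∣blocks∣ (g ∘ suc)))

⊥++⊥ : ∀ {a b} → ⊥ {a} ++ ⊥ {b} ≡ ⊥
⊥++⊥ {zero}  = refl
⊥++⊥ {suc a} = cong (false ∷_) (⊥++⊥ {a})

blocks-disjoint : ∀ {k m} (g g' : Fin k → Subset m) →
                  (∀ a → g a ∩ g' a ≡ ⊥) → blocks g ∩ blocks g' ≡ ⊥
blocks-disjoint {zero}  g g' disj = refl
blocks-disjoint {suc k} {m} g g' disj = begin
  (g zero ++ blocks (g ∘ suc)) ∩ (g' zero ++ blocks (g' ∘ suc))
    ≡⟨ zipWith-++ _ (g zero) (blocks (g ∘ suc)) (g' zero) (blocks (g' ∘ suc)) ⟩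
  (g zero ∩ g' zero) ++ (blocks (g ∘ suc) ∩ blocks (g' ∘ suc))
    ≡⟨ cong₂ _++_ (disj zero) (blocks-disjoint (g ∘ suc) (g' ∘ suc) (disj ∘ suc)) ⟩
  ⊥ {m} ++ ⊥ {k * m}
    ≡⟨ ⊥++⊥ {m} ⟩
  ⊥ ∎

disjoint⇒Empty : ∀ {k} {p q : Subset k} → p ∩ q ≡ ⊥ → Empty (p ∩ q)
disjoint⇒Empty p∩q≡⊥ (x , x∈p∩q) = ∉⊥ (subst (x ∈_) p∩q≡⊥ x∈p∩q)

-- The role pairs occurring at one point for two adjacent vertices.
data _⋈_ : Role → Role → Set where
  hd-tl : hd ⋈ tl
  tl-hd : tl ⋈ hd
  tl-ot : tl ⋈ ot
  ot-tl : ot ⋈ tl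
  ot-ot : ot ⋈ ot

-- The three adjacency conditions of H_{n:r}, read at a single point.
⋈-intro : ∀ {ρ ρ'} → (ρ ≡ hd → ρ' ≡ tl) → (ρ' ≡ hd → ρ ≡ tl) → ¬ (ρ ≡ tl × ρ' ≡ tl) →
          ρ ⋈ ρ'
⋈-intro {hd} {hd} hd→tl _ _ = contradiction (hd→tl refl) λ ()
⋈-intro {hd} {tl} _ _ _ = hd-tl
⋈-intro {hd} {ot} hd→tl _ _ = contradiction (hd→tl refl) λ ()
⋈-intro {tl} {hd} _ _ _ = tl-hd
⋈-intro {tl} {tl} _ _ notBoth = contradiction (refl , refl) notBoth
⋈-intro {tl} {ot} _ _ _ = tl-ot
⋈-intro {ot} {hd} _ hd→tl _ = contradiction (hd→tl refl) λ ()
⋈-intro {ot} {tl} _ _ _ = ot-tl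
⋈-intro {ot} {ot} _ _ _ = ot-ot

Compatible : ∀ {k} → Labelling k → Labelling k → Set
Compatible L L' = ∀ i → L i ⋈ L' i

-- Labellings of [d + m + 1] with one head, r tails and d + o other points,
-- where m = r + o; the ground set of S d is [(d + m + 1)!].
module Construction (r o : ℕ) where

  m : ℕ
  m = r + o

  baseBlock : Role → Subset (m !)
  baseBlock tl = ⊤
  baseBlock _  = ⊥

  stepBlock : ∀ {k} → Role → Subset k → Subset k
  stepBlock hd _ = ⊤
  stepBlock tl _ = ⊥
  stepBlock ot s = s

  S : ∀ d → Labelling (d + suc m) → Subset ((d + suc m) !)
  S zero    L = blocks (baseBlock ∘ L)
  S (suc d) L = blocks (λ a → stepBlock (L a) (S d (removeAt L a)))

  size : ℕ → ℕ
  size zero    = r * m !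
  size (suc d) = (d + suc m) ! + suc (d + o) * size d

  Proper : ∀ d → Labelling (d + suc m) → Set
  Proper d L = count L hd ≡ 1 × count L tl ≡ r × count L ot ≡ d + o

  proper-removeAt : ∀ {d} (L : Labelling (suc d + suc m)) a →
                    Proper (suc d) L → L a ≡ ot → Proper d (removeAt L a)
  proper-removeAt L a (#hd , #tl , #ot) La≡ot =
    trans (sym (drop hd)) #hd , trans (sym (drop tl)) #tl , suc-injective (trans (sym (drop ot)) #ot)
    where
    drop : ∀ ρ → count L ρ ≡ δ ρ ot + count (removeAt L a) ρ
    drop ρ = trans (count-removeAt L a ρ) (cong (λ σ → δ ρ σ + count (removeAt L a) ρ) La≡ot)

  -- Block by block: the head contributes a full block, each of the d + o + 1
  -- other points a copy of level d, at the base each tail a full block.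
  ∣S∣ : ∀ d (L : Labelling (d + suc m)) → Proper d L → ∣ S d L ∣ ≡ size d
  ∣S∣ zero L (#hd , #tl , _) = begin
    ∣ blocks (baseBlock ∘ L) ∣                         ≡⟨ ∣blocks∣ (baseBlock ∘ L) ⟩
    ∑[ a < suc m ] ∣ baseBlock (L a) ∣                 ≡⟨ sum-cong-≗ (∣baseBlock∣ ∘ L) ⟩
    ∑[ a < suc m ] ψ (L a)                             ≡⟨ ∑-by-role L ψ ⟩
    count L hd * 0 + count L tl * m ! + count L ot * 0
      ≡⟨ cong₂ (λ x y → x * 0 + y * m ! + count L ot * 0) #hd #tl ⟩
    r * m ! + count L ot * 0                           ≡⟨ cong (r * m ! +_) (*-zeroʳ (count L ot)) ⟩
    r * m ! + 0                                        ≡⟨ +-identityʳ _ ⟩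
    r * m ! ∎
    where
    ψ : Role → ℕ
    ψ tl = m !
    ψ _  = 0
    ∣baseBlock∣ : ∀ ρ → ∣ baseBlock ρ ∣ ≡ ψ ρ
    ∣baseBlock∣ hd = ∣⊥∣≡0 (m !)
    ∣baseBlock∣ tl = ∣⊤∣≡n (m !)
    ∣baseBlock∣ ot = ∣⊥∣≡0 (m !)
  ∣S∣ (suc d) L proper@(#hd , #tl , #ot) = begin
    ∣ blocks block ∣                                        ≡⟨ ∣blocks∣ block ⟩
    ∑[ a < suc N ] ∣ block a ∣                              ≡⟨ sum-cong-≗ ∣block∣ ⟩
    ∑[ a < suc N ] ψ (L a)                                  ≡⟨ ∑-by-role L ψ ⟩
    count L hd * N ! + count L tl * 0 + count L ot * size d
      ≡⟨ cong₂ (λ x y → x * N ! + count L tl * 0 + y * size d) #hd #ot ⟩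
    1 * N ! + count L tl * 0 + suc (d + o) * size d        ≡⟨ cong (_+ suc (d + o) * size d) headBlock ⟩
    N ! + suc (d + o) * size d ∎
    where
    N : ℕ
    N = d + suc m
    block : Fin (suc N) → Subset (N !)
    block a = stepBlock (L a) (S d (removeAt L a))
    ψ : Role → ℕ
    ψ hd = N !
    ψ tl = 0
    ψ ot = size d
    ∣block∣ : ∀ a → ∣ block a ∣ ≡ ψ (L a)
    ∣block∣ a with L a in La
    ... | hd = ∣⊤∣≡n (N !)
    ... | tl = ∣⊥∣≡0 (N !)
    ... | ot = ∣S∣ d (removeAt L a) (proper-removeAt L a proper La)
    headBlock : 1 * N ! + count L tl * 0 ≡ N !
    headBlock = trans (cong₂ _+_ (*-identityˡ (N !)) (*-zeroʳ (count L tl))) (+-identityʳ (N !))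

  baseBlock-disjoint : ∀ {ρ ρ'} → ρ ⋈ ρ' → baseBlock ρ ∩ baseBlock ρ' ≡ ⊥
  baseBlock-disjoint hd-tl = ∩-zeroˡ ⊤
  baseBlock-disjoint tl-hd = ∩-zeroʳ ⊤
  baseBlock-disjoint tl-ot = ∩-zeroʳ ⊤
  baseBlock-disjoint ot-tl = ∩-zeroˡ ⊤
  baseBlock-disjoint ot-ot = ∩-zeroˡ ⊥

  -- In a step block only two other points need the recursive disjointness.
  stepBlock-disjoint : ∀ {k ρ ρ'} {s s' : Subset k} → ρ ⋈ ρ' → s ∩ s' ≡ ⊥ →
                       stepBlock ρ s ∩ stepBlock ρ' s' ≡ ⊥
  stepBlock-disjoint hd-tl _ = ∩-zeroʳ ⊤
  stepBlock-disjoint tl-hd _ = ∩-zeroˡ ⊤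
  stepBlock-disjoint {s' = s'} tl-ot _ = ∩-zeroˡ s'
  stepBlock-disjoint {s = s} ot-tl _ = ∩-zeroʳ s
  stepBlock-disjoint ot-ot s∩s'≡⊥ = s∩s'≡⊥

  S-disjoint : ∀ d (L L' : Labelling (d + suc m)) → Compatible L L' → S d L ∩ S d L' ≡ ⊥
  S-disjoint zero L L' compat = blocks-disjoint _ _ (baseBlock-disjoint ∘ compat)
  S-disjoint (suc d) L L' compat = blocks-disjoint _ _ λ a →
    stepBlock-disjoint (compat a)
      (S-disjoint d (removeAt L a) (removeAt L' a) (compat ∘ punchIn a))

  size-closedForm : ∀ C → (r + 1) * size 0 ≡ suc m ! + C * o ! →
                    ∀ d → (r + 1) * size d ≡ (d + suc m) ! + C * (d + o) !
  size-closedForm C base zero    = base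
  size-closedForm C base (suc d) = begin
    (r + 1) * (A + s * size d)
      ≡⟨ solve 4 (λ r s A S → (r :+ con 1) :* (A :+ s :* S) := (r :+ con 1) :* A :+ s :* ((r :+ con 1) :* S))
               refl r s A (size d) ⟩
    (r + 1) * A + s * ((r + 1) * size d)
      ≡⟨ cong (λ x → (r + 1) * A + s * x) (size-closedForm C base d) ⟩
    (r + 1) * A + s * (A + C * F)
      ≡⟨ solve 6 (λ r o d A C F → (r :+ con 1) :* A :+ (con 1 :+ (d :+ o)) :* (A :+ C :* F)
                               := (con 1 :+ (d :+ (con 1 :+ (r :+ o)))) :* A :+ C :* ((con 1 :+ (d :+ o)) :* F))
               refl r o d A C F ⟩
    (suc d + suc m) ! + C * (suc d + o) ! ∎
    where
    A F s : ℕ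
    A = (d + suc m) !
    F = (d + o) !
    s = suc (d + o)

tailRole : Bool → Role
tailRole true  = tl
tailRole false = ot

roleOf : ∀ {n} → Fin n → Subset n → Labelling n
roleOf h T i = if does (i ≟ h) then hd else tailRole (lookup T i)

tailRole≢hd : ∀ b → tailRole b ≢ hd
tailRole≢hd true  ()
tailRole≢hd false ()

roleOf-head : ∀ {n} (h : Fin n) T → roleOf h T h ≡ hd
roleOf-head h T with h ≟ h
... | yes _ = refl
... | no h≢h = contradiction refl h≢h

roleOf-nonHead : ∀ {n} {h i : Fin n} T → i ≢ h → roleOf h T i ≡ tailRole (lookup T i)
roleOf-nonHead {h = h} {i} T i≢h with i ≟ h
... | yes i≡h = contradiction i≡h i≢h
... | no _    = refl

roleOf-hd : ∀ {n} {h i : Fin n} T → roleOf h T i ≡ hd → i ≡ h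
roleOf-hd {h = h} {i} T isHd with i ≟ h
... | yes i≡h = i≡h
... | no _    = contradiction isHd (tailRole≢hd (lookup T i))

roleOf-tl : ∀ {n} {h i : Fin n} T → roleOf h T i ≡ tl → i ∈ T
roleOf-tl {h = h} {i} T isTl with i ≟ h | lookup T i in Ti
... | yes _ | _    = contradiction isTl λ ()
... | no _  | true = lookup⇒[]= i T Ti

roleOf-tl⁺ : ∀ {n} {h i : Fin n} {T} → h ∉ T → i ∈ T → roleOf h T i ≡ tl
roleOf-tl⁺ {h = h} {i} {T} h∉T i∈T = trans (roleOf-nonHead T i≢h) (cong tailRole ([]=⇒lookup i∈T))
  where
  i≢h : i ≢ h
  i≢h = λ i≡h → h∉T (subst (_∈ T) i≡h i∈T)

count-tailRole : ∀ {n} (p : Subset n) → count (tailRole ∘ lookup p) tl ≡ ∣ p ∣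
count-tailRole []         = refl
count-tailRole (true  ∷ p) = cong suc (count-tailRole p)
count-tailRole (false ∷ p) = count-tailRole p

count-hd : ∀ {n} (h : Fin n) T → count (roleOf h T) hd ≡ 1
count-hd {suc n} h T = begin
  count (roleOf h T) hd                              ≡⟨ count-removeAt (roleOf h T) h hd ⟩
  δ hd (roleOf h T h) + count (removeAt (roleOf h T) h) hd
    ≡⟨ cong₂ _+_ (cong (δ hd) (roleOf-head h T)) noOtherHead ⟩
  1 ∎
  where
  noOtherHead : count (removeAt (roleOf h T) h) hd ≡ 0
  noOtherHead = trans (sum-cong-≗ λ i → trans (cong (δ hd) (roleOf-nonHead T (punchInᵢ≢i h i)))
                                              (δhd-tailRole _))
                      (sum-replicate-zero n)
    where
    δhd-tailRole : ∀ b → δ hd (tailRole b) ≡ 0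
    δhd-tailRole true  = refl
    δhd-tailRole false = refl

count-tl : ∀ {n} {h : Fin n} {T} → h ∉ T → count (roleOf h T) tl ≡ ∣ T ∣
count-tl {h = h} {T} h∉T = trans (sum-cong-≗ tailIndicator) (count-tailRole T)
  where
  tailIndicator : ∀ i → δ tl (roleOf h T i) ≡ δ tl (tailRole (lookup T i))
  tailIndicator i with i ≟ h | lookup T i in Ti
  ... | no _    | _     = refl
  ... | yes _   | false = refl
  ... | yes i≡h | true  = contradiction (subst (_∈ T) i≡h (lookup⇒[]= i T Ti)) h∉T

roleOf-compatible : ∀ {n r} (x y : HHVertex n r) → HHAdj x y →
                    Compatible (roleOf (head x) (tail x)) (roleOf (head y) (tail y))
roleOf-compatible x y (hx∈Ty , hy∈Tx , disjoint) i = ⋈-intro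
  (λ isHd → roleOf-tl⁺ (headOut y) (subst (_∈ tail y) (sym (roleOf-hd (tail x) isHd)) hx∈Ty))
  (λ isHd → roleOf-tl⁺ (headOut x) (subst (_∈ tail x) (sym (roleOf-hd (tail y) isHd)) hy∈Tx))
  (λ (tlx , tly) → disjoint (i , x∈p∩q⁺ (roleOf-tl (tail x) tlx , roleOf-tl (tail y) tly)))

module Homomorphism (r o d : ℕ) where
  open Construction r o

  N : ℕ
  N = d + suc m

  proper : (x : HHVertex N r) → Proper d (roleOf (head x) (tail x))
  proper x = #hd , #tl , +-cancelˡ-≡ (suc r) _ _ (trans allPoints levels)
    where
    L : Labelling N
    L = roleOf (head x) (tail x)
    #hd : count L hd ≡ 1
    #hd = count-hd (head x) (tail x)
    #tl : count L tl ≡ r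
    #tl = trans (count-tl (headOut x)) (tailCard x)
    allPoints : suc r + count L ot ≡ N
    allPoints = trans (cong₂ (λ a b → a + b + count L ot) (sym #hd) (sym #tl)) (count-total L)
    levels : N ≡ suc r + (d + o)
    levels = solve 3 (λ d r o → d :+ (con 1 :+ (r :+ o)) := con 1 :+ r :+ (d :+ o)) refl d r o

  φ : HHVertex N r → KVertex (N !) (size d)
  φ x = kv (S d (roleOf (head x) (tail x))) (∣S∣ d _ (proper x))

  φ-hom : IsHom φ
  φ-hom x y adj = disjoint⇒Empty (S-disjoint d _ _ (roleOf-compatible x y adj))

nPk*[n∸k]!≡n! : ∀ {n k} → k ≤ n → (n P k) * (n ∸ k) ! ≡ n !
nPk*[n∸k]!≡n! {n} {k} k≤n = begin
  (n P k) * (n ∸ k) !         ≡⟨ cong (_* (n ∸ k) !) (nPk≡n!/[n∸k]! k≤n) ⟩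
  n ! / (n ∸ k) ! * (n ∸ k) ! ≡⟨ m/n*n≡m (∣-trans (m∣m*n (k !)) ([n∸k]!k!∣n! k≤n)) ⟩
  n ! ∎
  where instance _ = (n ∸ k) !≢0

HomWithSize : ℕ → ℕ → Set
HomWithSize r n = Σ ℕ (λ r' → ((r + 1) * r' ≡ n ! + (r ∸ 1) * ((r * r) P r) * (n ∸ r ∸ 1) !)
                              × HHtoKneserHom n r (n !) r')

-- r = k + 2 tails and o = r² − r − 1 other points, so the base level is r².
module BaseSquare (k : ℕ) where
  r o : ℕ
  r = suc (suc k)
  o = suc (k * k + 3 * k)
  open Construction r o

  base≡r² : suc m ≡ r * r
  base≡r² = solve 1 (λ k → con 1 :+ ((con 2 :+ k) :+ (con 1 :+ (k :* k :+ con 3 :* k)))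
                         := (con 2 :+ k) :* (con 2 :+ k)) refl k

  r²∸r : r * r ∸ r ≡ suc o
  r²∸r = trans (cong (_∸ r) (sym r+[o+1]≡r²)) (m+n∸m≡n r (suc o))
    where
    r+[o+1]≡r² : r + suc o ≡ r * r
    r+[o+1]≡r² = trans (+-suc r o) base≡r²

  perm : ℕ
  perm = (r * r) P r

  -- (r − 1) · r²(r² − 1)⋯(r² − r + 1) · (r² − r − 1)! = r · (r² − 1)!,
  -- after multiplying by r, because r(r − 1) = r² − r = o + 1.
  correction : suc k * perm * o ! ≡ r * m !
  correction = *-cancelˡ-≡ _ _ r (begin
    r * (suc k * perm * o !) ≡⟨ solve 3 (λ k p F → (con 2 :+ k) :* ((con 1 :+ k) :* p :* F)
                                              := p :* ((con 1 :+ (con 1 :+ (k :* k :+ con 3 :* k))) :* F))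
                                         refl k perm (o !) ⟩
    perm * suc o !           ≡⟨ cong (λ x → perm * x !) (sym r²∸r) ⟩
    perm * (r * r ∸ r) !     ≡⟨ nPk*[n∸k]!≡n! (m≤m*n r r) ⟩
    (r * r) !                ≡⟨ cong _! (sym base≡r²) ⟩
    suc m * m !              ≡⟨ cong (_* m !) base≡r² ⟩
    r * r * m !              ≡⟨ *-assoc r r (m !) ⟩
    r * (r * m !) ∎)

  base : (r + 1) * size 0 ≡ suc m ! + suc k * perm * o !
  base = begin
    (r + 1) * (r * m !)
      ≡⟨ solve 2 (λ r F → (r :+ con 1) :* (r :* F) := r :* r :* F :+ r :* F) refl r (m !) ⟩
    r * r * m ! + r * m ! ≡⟨ cong₂ (λ x y → x * m ! + y) (sym base≡r²) (sym correction) ⟩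
    suc m ! + suc k * perm * o ! ∎

  others : ∀ d → d + suc m ∸ r ∸ 1 ≡ d + o
  others d = cong (_∸ 1) (trans (cong (_∸ r) e) (m+n∸m≡n r (suc (d + o))))
    where
    e : d + suc m ≡ r + suc (d + o)
    e = solve 3 (λ d r o → d :+ (con 1 :+ (r :+ o)) := r :+ (con 1 :+ (d :+ o))) refl d r o

  homAbove : ∀ d → HomWithSize r (d + r * r)
  homAbove d = subst (λ N → HomWithSize r (d + N)) base≡r² (size d , sizeFormula , φ , φ-hom)
    where
    open Homomorphism r o d
    sizeFormula : (r + 1) * size d ≡ N ! + suc k * perm * (N ∸ r ∸ 1) !
    sizeFormula = subst (λ x → (r + 1) * size d ≡ N ! + suc k * perm * x !) (sym (others d))
                        (size-closedForm (suc k * perm) base d)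

mainTheorem17 : (r n : ℕ) → 2 ≤ r → r * r ≤ n →
    Σ ℕ (λ r' → ((r + 1) * r' ≡ n ! + (r ∸ 1) * ((r * r) P r) * (n ∸ r ∸ 1) !)
    × HHtoKneserHom n r (n !) r')
mainTheorem17 (suc (suc k)) n (s≤s (s≤s z≤n)) r²≤n with m≤n⇒∃[o]m+o≡n r²≤n
... | d , r²+d≡n = subst (HomWithSize r) (trans (+-comm d (r * r)) r²+d≡n) (homAbove d)
  where open BaseSquare k
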